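{- Let $d\ge1$ and let $G=(V,E)$ be a connected graph with maximum degree at most $d$, and let $k$ be an integer with $1\le k\le |V|$. Then for every $v\in V$, $|Y_k(v)|\le d^3\cdot k^{\log k+1}$.
   Context: $\log$ is base 2. $d(u,v)$ is shortest-path distance in $G$, $\Gamma_\ell(v)=\{u: d(u,v)\le\ell\}$. For $u\in V$, $\ell_k(u)$ is the least integer $\ell\ge0$ with $|\Gamma_\ell(u)|\ge k$, and $B_k(u)=\Gamma_{\ell_k(u)}(u)$. Define $Y_k(v)=\{u\in V: v\in B_k(u)\}$. -}

module Defs where

open import Level using (0ℓ)
open import Data.Nat using (ℕ; zero; suc; _+_; _*_; _^_; _≤_; _<_)
open import Data.Fin using (Fin)
open import Data.List using (List; length)
open import Data.List.Relation.Unary.All using (All)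
open import Data.List.Relation.Unary.Unique.Propositional using (Unique)
open import Data.Product using (Σ; _×_; ∃; ∃-syntax)
open import Relation.Nullary using (¬_)
open import Relation.Binary.PropositionalEquality using (_≡_)

record Graph (n : ℕ) : Set₁ where
  field
    Adj   : Fin n → Fin n → Set
    sym   : ∀ {u v} → Adj u v → Adj v u
    irrefl : ∀ {v} → ¬ Adj v v

-- Cardinality bounds for (possibly undecidable) subsets of Fin n,
-- phrased via duplicate-free lists.
-- |S| ≥ k
AtLeast : ∀ {n} → ℕ → (Fin n → Set) → Set
AtLeast {n} k S = Σ (List (Fin n)) λ xs → Unique xs × All S xs × k ≤ length xs

AtMost : ∀ {n} → ℕ → (Fin n → Set) → Set
AtMost {n} m S = ∀ (xs : List (Fin n)) → Unique xs → All S xs → length xs ≤ m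

module _ {n : ℕ} (G : Graph n) where
  open Graph G

  data Walk : ℕ → Fin n → Fin n → Set where
    here : ∀ {u} → Walk zero u u
    step : ∀ {m u w v} → Adj u w → Walk m w v → Walk (suc m) u v

  DistLe : Fin n → Fin n → ℕ → Set
  DistLe u v ℓ = ∃[ m ] (m ≤ ℓ × Walk m u v)

  Connected : Set
  Connected = ∀ u v → ∃[ m ] Walk m u v

  MaxDegreeLe : ℕ → Set
  MaxDegreeLe d = ∀ v → AtMost d (Adj v)

  Γ : ℕ → Fin n → Fin n → Set
  Γ ℓ v u = DistLe u v ℓ

  IsRadius : ℕ → Fin n → ℕ → Set
  IsRadius k u ℓ = AtLeast k (Γ ℓ u) × (∀ ℓ' → ℓ' < ℓ → ¬ AtLeast k (Γ ℓ' u))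

  InB : ℕ → Fin n → Fin n → Set
  InB k u v = ∃[ ℓ ] (IsRadius k u ℓ × Γ ℓ u v)

  Y : ℕ → Fin n → Fin n → Set
  Y k v u = InB k u v

-- LeBound a d k  encodes the real inequality  a ≤ d^3 · k^(log₂ k + 1)
-- (for d, k ≥ 1) without reals: for every rational r = p/q > log₂ k
-- (i.e. k^q < 2^p, q ≥ 1) we have a ≤ d^3 · k^(r+1), raised to the q-th power.
-- Since k^(r+1) is continuous in r and decreasing to k^(log₂ k + 1) as r ↓ log₂ k,
-- this is equivalent to the real inequality.
LeBound : ℕ → ℕ → ℕ → Set
LeBound a d k = ∀ (p q : ℕ) → 1 ≤ q → k ^ q < 2 ^ p →
  a ^ q ≤ (d ^ 3) ^ q * k ^ (p + q)

{-# OPTIONS --safe #-}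
-- Let K = k - 1 and let u ≠ v lie in Y_k(v).  With r + 1 = d(u, v) ≤ ℓ_k(u), minimality of
-- ℓ_k(u) gives |Γ_r(u)| ≤ K, and the r + 1 vertices other than v on a shortest path from v
-- to u lie in Γ_r(u), so r < K.  Walking ⌊r/2⌋ steps from u towards v reaches a vertex w
-- with the same property at radius ⌈r/2⌉: v ∈ Γ_{⌈r/2⌉+1}(w), and Γ_{⌈r/2⌉}(w) ⊆ Γ_r(u) is
-- small and contains u.  For fixed w the small balls around w are nested, so their union
-- has at most K vertices.  Hence each halving of the radius multiplies the number of
-- candidates u by at most K, and after ⌊log k⌋ + 1 halvings the radius is at most 1,
-- leaving the at most 1 + d + d² vertices of Γ_2(v).  So |Y_k(v)| ≤ 1 + K^(⌊log k⌋+1) (1 + d + d²),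
-- which is at most d³ k^(⌊log k⌋+1) except when d = 1, where Y_k(v) ⊆ Γ_1(v) has at most
-- two vertices.
module Submission where

open import Level using (0ℓ)
open import Defs
open import Data.Nat
  using (ℕ; zero; suc; _+_; _*_; _^_; _≤_; _<_; z≤n; s≤s; s≤s⁻¹; NonZero; >-nonZero; ⌊_/2⌋; ⌈_/2⌉)
open import Data.Nat.Properties hiding (_≟_)
open import Data.Nat.Tactic.RingSolver using (solve-∀)
open import Data.Fin using (Fin; _≟_)
open import Data.List using (List; []; _∷_; length)
open import Data.List.Relation.Unary.All using (All; []; _∷_)
import Data.List.Relation.Unary.All as All
open import Data.List.Relation.Unary.All.Properties using (¬Any⇒All¬)
open import Data.List.Relation.Unary.AllPairs using ([]; _∷_)
open import Data.List.Relation.Unary.Any using (here; there)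
open import Data.List.Relation.Unary.Unique.Propositional using (Unique)
open import Data.List.Membership.Propositional using (_∈_)
open import Data.Product using (Σ-syntax; ∃-syntax; _×_; _,_; proj₁; proj₂)
open import Data.Sum using (_⊎_; inj₁; inj₂)
import Data.Sum as Sum
open import Relation.Nullary using (¬_; yes; no; contradiction)
open import Relation.Unary using (Pred; _⊆_; _∪_; _∩_; ∁; ｛_｝)
open import Relation.Binary.PropositionalEquality
  using (_≡_; refl; sym; trans; cong; subst)

module _ {n : ℕ} where

  private variable
    a b : ℕ
    P Q R : Pred (Fin n) 0ℓ
    x : Fin n

  AtMost-⊆ : P ⊆ Q → AtMost a Q → AtMost a P
  AtMost-⊆ P⊆Q h xs u ps = h xs u (All.map P⊆Q ps)

  AtMost-weaken : a ≤ b → AtMost a P → AtMost b P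
  AtMost-weaken a≤b h xs u ps = ≤-trans (h xs u ps) a≤b

  ¬AtLeast⇒AtMost : ¬ AtLeast (suc a) P → AtMost a P
  ¬AtLeast⇒AtMost ¬h xs u ps = ≮⇒≥ λ a<len → ¬h (xs , u , ps , a<len)

  AtMost-｛｝ : AtMost 1 ｛ x ｝
  AtMost-｛｝ []          _                  _                 = z≤n
  AtMost-｛｝ (_ ∷ [])    _                  _                 = s≤s z≤n
  AtMost-｛｝ (_ ∷ _ ∷ _) ((y≢z ∷ _) ∷ _) (refl ∷ refl ∷ _) = contradiction refl y≢z

  AtMost-0⇒∉ : AtMost 0 P → ¬ P x
  AtMost-0⇒∉ h px with h (_ ∷ []) ([] ∷ []) (px ∷ [])
  ... | ()

  AtMost-remove : AtMost (suc a) P → P x → AtMost a (P ∩ ∁ ｛ x ｝)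
  AtMost-remove h px ys u ps =
    s≤s⁻¹ (h (_ ∷ ys) (All.map proj₂ ps ∷ u) (px ∷ All.map proj₁ ps))

  AtMost-∪ : AtMost a P → AtMost b Q → AtMost (a + b) (P ∪ Q)
  AtMost-∪ _ _ [] _ _ = z≤n
  AtMost-∪ {a = zero} hP _ (_ ∷ _) _ (inj₁ px ∷ _) = contradiction px (AtMost-0⇒∉ hP)
  AtMost-∪ {a = suc a} hP hQ (x ∷ xs) (x∉xs ∷ u) (inj₁ px ∷ pqs) =
    s≤s (AtMost-∪ (AtMost-remove hP px) hQ xs u
          (All.zipWith (λ (x≢y , pq) → Sum.map₁ (_, x≢y) pq) (x∉xs , pqs)))
  AtMost-∪ {b = zero} _ hQ (_ ∷ _) _ (inj₂ qx ∷ _) = contradiction qx (AtMost-0⇒∉ hQ)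
  AtMost-∪ {a = a} {b = suc b} hP hQ (x ∷ xs) (x∉xs ∷ u) (inj₂ qx ∷ pqs) =
    subst (suc (length xs) ≤_) (sym (+-suc a b))
      (s≤s (AtMost-∪ hP (AtMost-remove hQ qx) xs u
             (All.zipWith (λ (x≢y , pq) → Sum.map₂ (_, x≢y) pq) (x∉xs , pqs))))

  AtMost-⋃ : {Q : Fin n → Pred (Fin n) 0ℓ} →
             AtMost a R → (∀ {w} → R w → AtMost b (Q w)) →
             AtMost (a * b) (λ u → ∃[ w ] R w × Q w u)
  AtMost-⋃ _ _ [] _ _ = z≤n
  AtMost-⋃ {a = zero} hR _ (_ ∷ _) _ ((_ , rw , _) ∷ _) = contradiction rw (AtMost-0⇒∉ hR)
  AtMost-⋃ {a = suc a} {R = R} {Q = Q} hR hQ xs@(_ ∷ _) u ps@((w₀ , rw₀ , _) ∷ _) =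
    AtMost-∪ (hQ rw₀) (AtMost-⋃ (AtMost-remove hR rw₀) (λ r → hQ (proj₁ r))) xs u
      (All.map separate ps)
    where
    separate : ∀ {u} → ∃[ w ] R w × Q w u → Q w₀ u ⊎ ∃[ w ] (R ∩ ∁ ｛ w₀ ｝) w × Q w u
    separate (w , rw , qwu) with w₀ ≟ w
    ... | yes refl  = inj₁ qwu
    ... | no w₀≢w = inj₂ (w , (rw , w₀≢w) , qwu)

module _ {n : ℕ} (G : Graph n) where

  open Graph G using (Adj) renaming (sym to Adj-sym)
  open import Data.List.Membership.DecPropositional (_≟_ {n}) using (_∈?_)

  private variable
    d i j m r : ℕ
    v x y z : Fin n

  _++_ : Walk G i x y → Walk G j y z → Walk G (i + j) x z
  here     ++ q = q
  step e p ++ q = step e (p ++ q)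

  _∷ʳ_ : Walk G m x y → Adj y z → Walk G (suc m) x z
  here     ∷ʳ e = step e here
  step e p ∷ʳ f = step e (p ∷ʳ f)

  reverse : Walk G m x y → Walk G m y x
  reverse here       = here
  reverse (step e p) = reverse p ∷ʳ Adj-sym e

  DistLe-refl : DistLe G x x r
  DistLe-refl = 0 , z≤n , here

  DistLe-mono : i ≤ j → DistLe G x y i → DistLe G x y j
  DistLe-mono i≤j (m , m≤i , p) = m , ≤-trans m≤i i≤j , p

  DistLe-sym : DistLe G x y r → DistLe G y x r
  DistLe-sym (m , m≤r , p) = m , m≤r , reverse p

  DistLe-trans : DistLe G x y i → DistLe G y z j → DistLe G x z (i + j)
  DistLe-trans (m , m≤i , p) (m′ , m′≤j , q) = m + m′ , +-mono-≤ m≤i m′≤j , p ++ q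

  DistLe-split : ∀ i j → DistLe G x z (i + j) → ∃[ y ] DistLe G x y i × DistLe G y z j
  DistLe-split zero    j x~z                      = _ , DistLe-refl , x~z
  DistLe-split (suc i) j (zero , _ , here)        = _ , DistLe-refl , DistLe-refl
  DistLe-split (suc i) j (suc m , m<1+i+j , step e p) with DistLe-split i j (m , s≤s⁻¹ m<1+i+j , p)
  ... | y , (m′ , m′≤i , p′) , y~z = y , (suc m′ , s≤s m′≤i , step e p′) , y~z

  targets : Walk G m x y → List (Fin n)
  targets here                = []
  targets (step {w = w} _ p) = w ∷ targets p

  length-targets : (p : Walk G m x y) → length (targets p) ≡ m
  length-targets here       = refl
  length-targets (step _ p) = cong suc (length-targets p)

  targets-near : (p : Walk G (suc r) x y) → All (Γ G r y) (targets p)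
  targets-near (step _ here)         = DistLe-refl ∷ []
  targets-near (step _ p@(step _ _)) =
    (_ , ≤-refl , p) ∷ All.map (DistLe-mono (n≤1+n _)) (targets-near p)

  suffix : (p : Walk G m x y) → Unique (targets p) → z ∈ targets p →
           ∃[ m′ ] m′ ≤ m × Σ[ q ∈ Walk G m′ z y ] Unique (z ∷ targets q)
  suffix (step _ p) uniq         (here refl) = _ , n≤1+n _ , p , uniq
  suffix (step _ p) (_ ∷ uniq) (there z∈) with suffix p uniq z∈
  ... | m′ , m′≤m , q , uniq′ = m′ , m≤n⇒m≤1+n m′≤m , q , uniq′

  shortcut : Walk G m x y → ∃[ m′ ] m′ ≤ m × Σ[ q ∈ Walk G m′ x y ] Unique (targets q)
  shortcut here = 0 , z≤n , here , []
  shortcut (step {w = w} e p) with shortcut p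
  ... | m′ , m′≤m , q , uniq with w ∈? targets q
  ...   | yes w∈ = let m″ , m″≤m′ , q′ , uniq′ = suffix q uniq w∈
                   in suc m″ , s≤s (≤-trans m″≤m′ m′≤m) , step e q′ , uniq′
  ...   | no w∉  = suc m′ , s≤s m′≤m , step e q , ¬Any⇒All¬ _ w∉ ∷ uniq

  ball₂-atMost : MaxDegreeLe G d → AtMost (1 + d + d * d) (Γ G 2 v)
  ball₂-atMost {v = v} Δ =
    AtMost-⊆ classify (AtMost-∪ (AtMost-∪ AtMost-｛｝ (Δ v)) (AtMost-⋃ (Δ v) (λ {w} _ → Δ w)))
    where
    classify : Γ G 2 v ⊆ (｛ v ｝ ∪ Adj v) ∪ (λ u → ∃[ w ] Adj v w × Adj w u)
    classify (0 , _ , here)                   = inj₁ (inj₁ refl)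
    classify (1 , _ , step e here)            = inj₁ (inj₂ (Adj-sym e))
    classify (2 , _ , step e (step f here))   = inj₂ (_ , Adj-sym f , Adj-sym e)
    classify (suc (suc (suc _)) , s≤s (s≤s ()) , _)

  walk-in-MaxDegreeLe1 : MaxDegreeLe G 1 → Walk G m x y → x ≡ y ⊎ Adj x y
  walk-in-MaxDegreeLe1 Δ here = inj₁ refl
  walk-in-MaxDegreeLe1 {x = x} {y = y} Δ (step {w = w} e p) with walk-in-MaxDegreeLe1 Δ p
  ... | inj₁ refl = inj₂ e
  ... | inj₂ f with x ≟ y
  ...   | yes x≡y = inj₁ x≡y
  ...   | no x≢y with Δ w (x ∷ y ∷ []) ((x≢y ∷ []) ∷ [] ∷ []) (Adj-sym e ∷ f ∷ [])
  ...     | s≤s ()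

module _ {n : ℕ} (G : Graph n) (K : ℕ) where

  private variable
    R : ℕ
    u v w : Fin n
    xs : List (Fin n)

  InSmallBall : Fin n → Pred (Fin n) 0ℓ
  InSmallBall w u = ∃[ c ] AtMost K (Γ G c w) × Γ G c w u

  -- The balls around w are nested, so finitely many points of small balls lie in one of them.
  common-small-ball : ∀ {c} → AtMost K (Γ G c w) → All (InSmallBall w) xs →
                      ∃[ c′ ] AtMost K (Γ G c′ w) × All (Γ G c′ w) xs
  common-small-ball small []                               = _ , small , []
  common-small-ball small ((c , small-c , u∈) ∷ in-balls) with common-small-ball small in-balls
  ... | c′ , small-c′ , xs∈ with ≤-total c c′
  ...   | inj₁ c≤c′ = c′ , small-c′ , DistLe-mono G c≤c′ u∈ ∷ xs∈
  ...   | inj₂ c′≤c = c , small-c , u∈ ∷ All.map (DistLe-mono G c′≤c) xs∈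

  InSmallBall-atMost : AtMost K (InSmallBall w)
  InSmallBall-atMost []           _    _ = z≤n
  InSmallBall-atMost xs@(_ ∷ _) uniq in-balls@((_ , small , _) ∷ _) =
    let _ , small′ , xs∈ = common-small-ball small in-balls in small′ xs uniq xs∈

  Near : Fin n → ℕ → Pred (Fin n) 0ℓ
  Near v R u = ∃[ r ] r ≤ R × Γ G (suc r) u v × AtMost K (Γ G r u)

  Near-halve : Near v (2 * R) u → ∃[ w ] Near v R w × InSmallBall w u
  Near-halve {v = v} {R = R} {u = u} (r , r≤2R , v∈Γ , small) =
    let w , v∈Γw , w∈Γu = DistLe-split G (suc c) h
                             (subst (λ s → DistLe G v u (suc s)) (sym c+h≡r) v∈Γ)
        small-w = AtMost-⊆ (λ x∈Γw → subst (DistLe G _ u) c+h≡r (DistLe-trans G x∈Γw w∈Γu))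
                           small
        u∈Γw = DistLe-mono G (⌊n/2⌋≤⌈n/2⌉ r) (DistLe-sym G w∈Γu)
    in w , (c , c≤R , v∈Γw , small-w) , (c , small-w , u∈Γw)
    where
    h c : ℕ
    h = ⌊ r /2⌋
    c = ⌈ r /2⌉
    c+h≡r : c + h ≡ r
    c+h≡r = trans (+-comm c h) (⌊n/2⌋+⌈n/2⌉≡n r)
    c≤R : c ≤ R
    c≤R = ≤-trans (⌈n/2⌉-mono r≤2R)
            (≤-reflexive (trans (cong (λ s → ⌈ R + s /2⌉) (+-identityʳ R)) (sym (n≡⌈n+n/2⌉ R))))

  Near-atMost : ∀ {d} → MaxDegreeLe G d → ∀ t → AtMost (K ^ t * (1 + d + d * d)) (Near v (2 ^ t))
  Near-atMost Δ zero =
    AtMost-weaken (≤-reflexive (sym (*-identityˡ _)))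
      (AtMost-⊆ (λ (_ , r≤1 , v∈Γ , _) → DistLe-sym G (DistLe-mono G (s≤s r≤1) v∈Γ))
                (ball₂-atMost G Δ))
  Near-atMost {d = d} Δ (suc t) =
    AtMost-weaken (≤-reflexive count)
      (AtMost-⊆ Near-halve (AtMost-⋃ (Near-atMost Δ t) (λ _ → InSmallBall-atMost)))
    where
    count : K ^ t * (1 + d + d * d) * K ≡ K ^ suc t * (1 + d + d * d)
    count = trans (*-comm _ K) (sym (*-assoc K (K ^ t) _))

  Y⊆｛｝∪Near : K ≤ R → Y G (suc K) v ⊆ ｛ v ｝ ∪ Near v R
  Y⊆｛｝∪Near {R = R} {v = v} K≤R {u} (ℓ , (_ , below-ℓ-small) , (_ , m≤ℓ , p)) with shortcut G p
  ... | zero  , _    , here , _    = inj₁ refl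
  ... | suc r , r<m , q    , uniq = inj₂ (r , ≤-trans (<⇒≤ r<K) K≤R , (suc r , ≤-refl , q) , small)
    where
    small : AtMost K (Γ G r u)
    small = ¬AtLeast⇒AtMost (below-ℓ-small r (≤-trans r<m m≤ℓ))
    r<K : r < K
    r<K = subst (_≤ K) (length-targets G q) (small (targets G q) uniq (targets-near G q))

Y-atMost-halving : ∀ {n d K} (G : Graph n) → MaxDegreeLe G d → ∀ t → K ≤ 2 ^ t → (v : Fin n) →
                  AtMost (1 + K ^ t * (1 + d + d * d)) (Y G (suc K) v)
Y-atMost-halving G Δ t K≤2^t v =
  AtMost-⊆ (Y⊆｛｝∪Near G _ K≤2^t) (AtMost-∪ AtMost-｛｝ (Near-atMost G _ Δ t))

Y-atMost-MaxDegreeLe1 : ∀ {n k} (G : Graph n) → MaxDegreeLe G 1 → (v : Fin n) → AtMost 2 (Y G k v)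
Y-atMost-MaxDegreeLe1 G Δ v =
  AtMost-⊆ (λ (_ , _ , (_ , _ , p)) → walk-in-MaxDegreeLe1 G Δ p) (AtMost-∪ AtMost-｛｝ (Δ v))

-- This is (2 + x) ^ 3 unfolded, which is the form the ring solver accepts.
[2+x]³-expansion : ∀ x → (2 + x) * ((2 + x) * ((2 + x) * 1)) ≡
                   (2 + (2 + x) + (2 + x) * (2 + x)) + x * (7 + x * (5 + x))
[2+x]³-expansion = solve-∀

2+d+d²≤d³ : ∀ {d} → 2 ≤ d → 2 + d + d * d ≤ d ^ 3
2+d+d²≤d³ {suc (suc e)} (s≤s (s≤s z≤n)) =
  subst (2 + (2 + e) + (2 + e) * (2 + e) ≤_) (sym ([2+x]³-expansion e)) (m≤m+n _ _)

Y-atMost : ∀ {n d k t} (G : Graph n) → 1 ≤ d → MaxDegreeLe G d → 1 ≤ k → k ≤ 2 ^ suc t →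
           (v : Fin n) → AtMost (d ^ 3 * k ^ suc t) (Y G k v)
Y-atMost {d = d@(suc _)} {k = 1} {t} G _ Δ _ _ v =
  AtMost-weaken (*-mono-≤ (m^n>0 d 3) (m^n>0 1 (suc t))) (Y-atMost-halving G Δ (suc t) z≤n v)
Y-atMost {d = 1} {k = k@(suc (suc _))} {t} G _ Δ _ _ v =
  AtMost-weaken (begin
    2           ≤⟨ s≤s (s≤s z≤n) ⟩
    k           ≤⟨ m≤m*n k (k ^ t) {{m^n≢0 k t}} ⟩
    k ^ suc t   ≡⟨ sym (*-identityˡ _) ⟩
    1 * k ^ suc t ∎)
    (Y-atMost-MaxDegreeLe1 G Δ v)
  where open ≤-Reasoning
Y-atMost {d = d@(suc (suc _))} {k = suc K} {t} G _ Δ _ k≤2^[1+t] v =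
  AtMost-weaken (begin
    1 + K ^ suc t * B          ≤⟨ +-mono-≤ (m^n>0 k (suc t))
                                           (*-monoˡ-≤ B (^-monoˡ-≤ (suc t) (n≤1+n K))) ⟩
    k ^ suc t + k ^ suc t * B  ≡⟨ sym (*-suc (k ^ suc t) B) ⟩
    k ^ suc t * suc B          ≤⟨ *-monoʳ-≤ (k ^ suc t) (2+d+d²≤d³ (s≤s (s≤s z≤n))) ⟩
    k ^ suc t * d ^ 3          ≡⟨ *-comm (k ^ suc t) (d ^ 3) ⟩
    d ^ 3 * k ^ suc t          ∎)
    (Y-atMost-halving G Δ (suc t) (≤-trans (n≤1+n K) k≤2^[1+t]) v)
  where
  open ≤-Reasoning
  k = suc K
  B = 1 + d + d * d

∃⌊log₂⌋ : ∀ k → 1 ≤ k → ∃[ L ] 2 ^ L ≤ k × k < 2 ^ suc L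
∃⌊log₂⌋ 1 _ = 0 , ≤-refl , s≤s (s≤s z≤n)
∃⌊log₂⌋ (suc k@(suc _)) _ with ∃⌊log₂⌋ k (s≤s z≤n)
... | L , 2^L≤k , k<2^[1+L] with suc k <? 2 ^ suc L
...   | yes 1+k<2^[1+L] = L , m≤n⇒m≤1+n 2^L≤k , 1+k<2^[1+L]
...   | no  1+k≮2^[1+L] =
  suc L , ≤-reflexive (sym 1+k≡2^[1+L]) ,
  subst (_< 2 ^ suc (suc L)) (sym 1+k≡2^[1+L]) (^-monoʳ-< 2 (s≤s (s≤s z≤n)) (n<1+n (suc L)))
  where
  1+k≡2^[1+L] : suc k ≡ 2 ^ suc L
  1+k≡2^[1+L] = ≤-antisym k<2^[1+L] (≮⇒≥ 1+k≮2^[1+L])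

^-distribʳ-* : ∀ m n o → (m * n) ^ o ≡ m ^ o * n ^ o
^-distribʳ-* m n zero    = refl
^-distribʳ-* m n (suc o) =
  trans (cong (m * n *_) (^-distribʳ-* m n o)) ([m*n]*[o*p]≡[m*o]*[n*p] m n (m ^ o) (n ^ o))

LeBound-intro : ∀ {a d k L} → 2 ^ L ≤ k → a ≤ d ^ 3 * k ^ suc L → LeBound a d k
LeBound-intro {a} {d} {k} {L} 2^L≤k a≤ p q _ k^q<2^p = begin
  a ^ q                          ≤⟨ ^-monoˡ-≤ q a≤ ⟩
  (d ^ 3 * k ^ suc L) ^ q        ≡⟨ ^-distribʳ-* (d ^ 3) (k ^ suc L) q ⟩
  (d ^ 3) ^ q * (k ^ suc L) ^ q  ≡⟨ cong ((d ^ 3) ^ q *_) (^-*-assoc k (suc L) q) ⟩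
  (d ^ 3) ^ q * k ^ (suc L * q)  ≤⟨ *-monoʳ-≤ ((d ^ 3) ^ q) (^-monoʳ-≤ k [1+L]q≤p+q) ⟩
  (d ^ 3) ^ q * k ^ (p + q)      ∎
  where
  open ≤-Reasoning
  instance
    k≢0 : NonZero k
    k≢0 = >-nonZero (≤-trans (m^n>0 2 L) 2^L≤k)
  Lq<p : L * q < p
  Lq<p = ≰⇒> λ p≤Lq → <⇒≱ k^q<2^p (begin
    2 ^ p        ≤⟨ ^-monoʳ-≤ 2 p≤Lq ⟩
    2 ^ (L * q)  ≡⟨ sym (^-*-assoc 2 L q) ⟩
    (2 ^ L) ^ q  ≤⟨ ^-monoˡ-≤ q 2^L≤k ⟩
    k ^ q        ∎)
  [1+L]q≤p+q : suc L * q ≤ p + q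
  [1+L]q≤p+q = ≤-trans (+-monoʳ-≤ q (<⇒≤ Lq<p)) (≤-reflexive (+-comm q p))

lemma3p7 : (n d k : ℕ) (G : Graph n) → 1 ≤ d → Connected G → MaxDegreeLe G d →
    1 ≤ k → k ≤ n → (v : Fin n) →
    (xs : List (Fin n)) → Unique xs → All (Y G k v) xs → LeBound (length xs) d k
lemma3p7 n d k G 1≤d _ Δ 1≤k _ v xs uniq in-Y =
  let L , 2^L≤k , k<2^[1+L] = ∃⌊log₂⌋ k 1≤k
  in LeBound-intro {d = d} {L = L} 2^L≤k
       (Y-atMost {t = L} G 1≤d Δ 1≤k (<⇒≤ k<2^[1+L]) v xs uniq in-Y)
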